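{- Let $n\ge2$, $\mathbf{b}=b_1\cdots b_{n-2}\in\{0,1\}^{n-2}$, and $k\in[n-2]$. Draw $G_{\mathbf{b}}$ with vertex $v$ at $(v,0)$, the spine edges $(v,v+1)$, $v\in[n]$, as horizontal segments, and every other edge $(p,q)$ as the upper semicircle with diameter $[p,q]$ on the $x$-axis. Then this drawing has two edges crossing at a point with $x$-coordinate strictly between $k+1$ and $k+2$ if and only if $b_k=1$.
   Context: For $\mathbf{b}\in\{0,1\}^{n-2}$ with $\{i:b_i=1\}=\{j_1<\dots<j_r\}$, $G_{\mathbf{b}}$ is the DAG on vertex set $[n+1]$ whose edge multiset consists of: the spine edges $(i,i+1)$ for $i\in[n]$; additional (non-spine) copies of $(1,2)$ and $(n,n+1)$; an additional non-spine copy of $(l+1,l+2)$ for each $l\in[n-2]$ with $b_l=0$; and the non-spine edges $(1,j_1+2),(j_1+1,j_2+2),\dots,(j_{r-1}+1,j_r+2),(j_r+1,n+1)$ (just $(1,n+1)$ if $r=0$). These are exactly the DAGs on $[n+1]$ with out-degree sequence $(3,2,\dots,2,0)$ and in-degree sequence $(0,2,\dots,2,3)$. -}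

module Defs where

open import Data.Bool using (Bool; true; false)
open import Data.Nat using (ℕ; zero; suc; _∸_)
import Data.Nat as ℕ
open import Data.Integer using (+_)
open import Data.Rational using (ℚ; _/_; _+_; _-_; _*_; _≤_; _<_; 0ℚ; ½)
open import Data.List using (List; []; _∷_; _++_; length; lookup; upTo; map)
open import Data.Vec using (Vec; toList)
open import Data.Fin using (Fin)
open import Data.Product using (_×_; _,_; Σ; ∃; ∃-syntax)
open import Relation.Binary.PropositionalEquality using (_≡_; _≢_)

-- An edge (src , tgt) of the DAG, together with a flag: true = spine edge
-- (drawn as a horizontal segment), false = non-spine edge (drawn as the upper
-- semicircle with diameter [src, tgt] on the x-axis).
record Edge : Set where
  constructor edge
  field
    src   : ℕ
    tgt   : ℕ
    spine : Bool

⟦_⟧ : ℕ → ℚ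
⟦ m ⟧ = + m / 1

-- positions l (1-based, starting at i) where the bit is 1 / 0
ones : ℕ → List Bool → List ℕ
ones i []            = []
ones i (true ∷ bs)   = i ∷ ones (suc i) bs
ones i (false ∷ bs)  = ones (suc i) bs

zeros : ℕ → List Bool → List ℕ
zeros i []           = []
zeros i (true ∷ bs)  = zeros (suc i) bs
zeros i (false ∷ bs) = i ∷ zeros (suc i) bs

chain : ℕ → List ℕ → ℕ → List Edge
chain s []       t = edge s t false ∷ []
chain s (j ∷ js) t = edge s (suc (suc j)) false ∷ chain (suc j) js t

G : (n : ℕ) → Vec Bool (n ∸ 2) → List Edge
G n b =
     map (λ i → edge (suc i) (suc (suc i)) true) (upTo n)
  ++ (edge 1 2 false ∷ edge n (suc n) false ∷ [])
  ++ map (λ l → edge (suc l) (suc (suc l)) false) (zeros 1 bl)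
  ++ chain 1 (ones 1 bl) (suc n)
  where bl = toList b

-- Points of the closed upper half plane {y ≥ 0}, encoded as (x , Y) with
-- Y = y² (a bijection onto {Y ≥ 0}, since y ≥ 0); this avoids square roots.
Point : Set
Point = ℚ × ℚ

OnCurve : Edge → Point → Set
OnCurve (edge p q true)  (x , Y) = Y ≡ 0ℚ × ⟦ p ⟧ ≤ x × x ≤ ⟦ q ⟧
OnCurve (edge p q false) (x , Y) =
  0ℚ ≤ Y × (x - c) * (x - c) + Y ≡ r * r
  where c = (⟦ p ⟧ + ⟦ q ⟧) * ½
        r = (⟦ q ⟧ - ⟦ p ⟧) * ½

-- Two (distinct members of the multiset of) edges of the drawing meet at a point
-- whose x-coordinate lies strictly between lo and hi.
CrossingBetween : List Edge → ℚ → ℚ → Set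
CrossingBetween es lo hi =
  Σ (Fin (length es)) λ i → Σ (Fin (length es)) λ j → i ≢ j ×
  Σ Point λ pt → OnCurve (lookup es i) pt × OnCurve (lookup es j) pt ×
                 lo < Data.Product.proj₁ pt × Data.Product.proj₁ pt < hi

module Submission where

-- Over the open interval (l, l+1), l = k+1, the drawing consists of the spine edge (l, l+1) at height 0
-- and of the arcs (p, q) with p ≤ l < l+1 ≤ q, at squared height (x - p)(q - x) > 0.  Of two such
-- arcs with p' < p and q < q' the outer one is strictly higher, so they do not meet there.  If b_k = 0
-- the arcs spanning the interval are the extra copy of (l, l+1) and a single chain edge strictly
-- containing it, so no two edges meet.  If b_k = 1, the chain edges (p, k+2) and (k+1, q) on either
-- side of the cut at k cross: the difference of their squared heights is affine in x and changes
-- sign on the interval.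

open import Defs
open import Data.Bool using (Bool; true; false; not)
open import Data.Nat as ℕ using (ℕ; suc; _≤_; _<_; _∸_; z≤n; s≤s)
import Data.Nat.Properties as ℕ
import Data.Nat.Coprimality as Coprime
import Data.Integer as ℤ
import Data.Integer.Properties as ℤ
open import Data.Rational as ℚ using (ℚ; mkℚ; 0ℚ; 1ℚ; ½; _+_; _-_; _*_; -_; 1/_)
import Data.Rational.Properties as ℚ
open import Data.Rational.Solver using (module +-*-Solver)
open import Algebra.Properties.Group ℚ.+-0-group using (∙-cancelˡ)
open import Data.Fin using (Fin; toℕ)
import Data.Fin.Properties as Fin
open import Data.List as List using (List; []; _∷_; _++_; upTo; length)
open import Data.List.Membership.Propositional using (_∈_; _∉_)
open import Data.List.Membership.Propositional.Properties using (∈-lookup; ∈-++⁺ʳ)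
open import Data.List.Relation.Unary.Any using (here; there; index)
open import Data.List.Relation.Unary.Any.Properties using (lookup-index)
open import Data.List.Relation.Unary.All as All using (All; []; _∷_)
import Data.List.Relation.Unary.All.Properties as All
open import Data.List.Relation.Unary.AllPairs as AllPairs using (AllPairs; []; _∷_)
import Data.List.Relation.Unary.AllPairs.Properties as AllPairs
open import Data.Vec as Vec using (Vec; toList; lookup)
import Data.Vec.Properties as Vec
open import Data.Product using (_×_; _,_; proj₁; proj₂; ∃; ∃₂)
open import Data.Sum using (_⊎_; inj₁; inj₂; [_,_])
open import Data.Empty using (⊥; ⊥-elim)
open import Function using (_∘_)
open import Relation.Nullary using (¬_)
open import Relation.Binary.PropositionalEquality hiding ([_])

open Edge

private variable
  A : Set
  i l p q p' q' s t : ℕ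
  b : Bool
  e e' : Edge
  js : List ℕ
  es : List Edge
  x Y : ℚ

⟦⟧≡mkℚ : ∀ m → ⟦ m ⟧ ≡ mkℚ (ℤ.+ m) 0 (Coprime.sym (Coprime.1-coprimeTo m))
⟦⟧≡mkℚ m = ℚ.normalize-coprime _

⟦⟧-mono-≤ : ∀ {m n} → m ≤ n → ⟦ m ⟧ ℚ.≤ ⟦ n ⟧
⟦⟧-mono-≤ {m} {n} m≤n rewrite ⟦⟧≡mkℚ m | ⟦⟧≡mkℚ n =
  ℚ.*≤* (subst₂ ℤ._≤_ (sym (ℤ.*-identityʳ (ℤ.+ m))) (sym (ℤ.*-identityʳ (ℤ.+ n))) (ℤ.+≤+ m≤n))

⟦⟧-mono-< : ∀ {m n} → m < n → ⟦ m ⟧ ℚ.< ⟦ n ⟧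
⟦⟧-mono-< {m} {n} m<n rewrite ⟦⟧≡mkℚ m | ⟦⟧≡mkℚ n =
  ℚ.*<* (subst₂ ℤ._<_ (sym (ℤ.*-identityʳ (ℤ.+ m))) (sym (ℤ.*-identityʳ (ℤ.+ n))) (ℤ.+<+ m<n))

<⇒≱ : ∀ {a b} → a ℚ.< b → ¬ b ℚ.≤ a
<⇒≱ a<b b≤a = ℚ.<-irrefl refl (ℚ.<-≤-trans a<b b≤a)

⟦⟧-cancel-< : ∀ {m n} → ⟦ m ⟧ ℚ.< ⟦ n ⟧ → m < n
⟦⟧-cancel-< ⟦m⟧<⟦n⟧ = ℕ.≰⇒> (λ n≤m → <⇒≱ ⟦m⟧<⟦n⟧ (⟦⟧-mono-≤ n≤m))

p<q⇒0<q-p : ∀ {a b} → a ℚ.< b → 0ℚ ℚ.< b - a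
p<q⇒0<q-p {a} {b} a<b = subst (ℚ._< b - a) (ℚ.+-inverseʳ a) (ℚ.+-monoˡ-< (- a) a<b)

p<q⇒p-q<0 : ∀ {a b} → a ℚ.< b → a - b ℚ.< 0ℚ
p<q⇒p-q<0 {a} {b} a<b = subst (a - b ℚ.<_) (ℚ.+-inverseʳ b) (ℚ.+-monoˡ-< (- b) a<b)

pos*pos : ∀ {a b} → 0ℚ ℚ.< a → 0ℚ ℚ.< b → 0ℚ ℚ.< a * b
pos*pos {a} {b} 0<a 0<b =
  ℚ.positive⁻¹ (a * b) {{ℚ.pos*pos⇒pos a {{ℚ.positive 0<a}} b {{ℚ.positive 0<b}}}}

neg*pos : ∀ {a b} → a ℚ.< 0ℚ → 0ℚ ℚ.< b → a * b ℚ.< 0ℚ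
neg*pos {a} {b} a<0 0<b =
  ℚ.negative⁻¹ (a * b) {{ℚ.neg*pos⇒neg a {{ℚ.negative a<0}} b {{ℚ.positive 0<b}}}}

pos*neg : ∀ {a b} → 0ℚ ℚ.< a → b ℚ.< 0ℚ → a * b ℚ.< 0ℚ
pos*neg {a} {b} 0<a b<0 =
  ℚ.negative⁻¹ (a * b) {{ℚ.pos*neg⇒neg a {{ℚ.positive 0<a}} b {{ℚ.negative b<0}}}}

*-mono-<-pos : ∀ {a a' b b'} → 0ℚ ℚ.< a → 0ℚ ℚ.< b → a ℚ.< a' → b ℚ.< b' → a * b ℚ.< a' * b'
*-mono-<-pos {a} {a'} {b} {b'} 0<a 0<b a<a' b<b' = ℚ.<-trans
  (ℚ.*-monoˡ-<-pos b {{ℚ.positive 0<b}} a<a')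
  (ℚ.*-monoʳ-<-pos a' {{ℚ.positive (ℚ.<-trans 0<a a<a')}} b<b')

circle-on-diameter : ∀ x a b →
  (x - (a + b) * ½) * (x - (a + b) * ½) + (x - a) * (b - x) ≡ ((b - a) * ½) * ((b - a) * ½)
circle-on-diameter = solve 3 (λ x a b →
     (x :- (a :+ b) :* con ½) :* (x :- (a :+ b) :* con ½) :+ (x :- a) :* (b :- x)
  := ((b :- a) :* con ½) :* ((b :- a) :* con ½)) refl
  where open +-*-Solver

arcHeight² : ℕ → ℕ → ℚ → ℚ
arcHeight² p q x = (x - ⟦ p ⟧) * (⟦ q ⟧ - x)

onArc⇒height : ∀ p q x → OnCurve (edge p q false) (x , Y) → Y ≡ arcHeight² p q x
onArc⇒height p q x (_ , onCircle) =
  ∙-cancelˡ (let d = x - (⟦ p ⟧ + ⟦ q ⟧) * ½ in d * d) _ _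
            (trans onCircle (sym (circle-on-diameter x ⟦ p ⟧ ⟦ q ⟧)))

height⇒onArc : ∀ p q x → 0ℚ ℚ.≤ Y → Y ≡ arcHeight² p q x → OnCurve (edge p q false) (x , Y)
height⇒onArc p q x 0≤Y refl = 0≤Y , circle-on-diameter x ⟦ p ⟧ ⟦ q ⟧

Forward : Edge → Set
Forward e = src e < tgt e

record Covers (l : ℕ) (e : Edge) : Set where
  constructor covers
  field
    src≤ : src e ≤ l
    <tgt : l < tgt e

InOpenUnit : ℕ → ℚ → Set
InOpenUnit l x = ⟦ l ⟧ ℚ.< x × x ℚ.< ⟦ suc l ⟧

covers⇒0<x-p : Covers l (edge p q b) → InOpenUnit l x → 0ℚ ℚ.< x - ⟦ p ⟧
covers⇒0<x-p (covers p≤l _) (l<x , _) = p<q⇒0<q-p (ℚ.≤-<-trans (⟦⟧-mono-≤ p≤l) l<x)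

covers⇒0<q-x : Covers l (edge p q b) → InOpenUnit l x → 0ℚ ℚ.< ⟦ q ⟧ - x
covers⇒0<q-x (covers _ l<q) (_ , x<l+1) = p<q⇒0<q-p (ℚ.<-≤-trans x<l+1 (⟦⟧-mono-≤ l<q))

arcHeight²-pos : Covers l (edge p q b) → InOpenUnit l x → 0ℚ ℚ.< arcHeight² p q x
arcHeight²-pos cov I = pos*pos (covers⇒0<x-p cov I) (covers⇒0<q-x cov I)

arcHeight²-<-nested : p' < p → q < q' → Covers l (edge p q b) → InOpenUnit l x →
                      arcHeight² p q x ℚ.< arcHeight² p' q' x
arcHeight²-<-nested {x = x} p'<p q<q' cov I = *-mono-<-pos (covers⇒0<x-p cov I) (covers⇒0<q-x cov I)
  (ℚ.+-monoʳ-< x (ℚ.neg-antimono-< (⟦⟧-mono-< p'<p)))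
  (ℚ.+-monoˡ-< (- x) (⟦⟧-mono-< q<q'))

onCurve⇒covers : Forward e → InOpenUnit l x → OnCurve e (x , Y) → Covers l e
onCurve⇒covers {edge p q true} _ (l<x , x<l+1) (_ , p≤x , x≤q) =
  covers (ℕ.≤-pred (⟦⟧-cancel-< (ℚ.≤-<-trans p≤x x<l+1))) (⟦⟧-cancel-< (ℚ.<-≤-trans l<x x≤q))
onCurve⇒covers {edge p q false} {l} {x} p<q (l<x , x<l+1) onArc = covers (ℕ.≮⇒≥ p≰l) (ℕ.≰⇒> q≰l)
  where
  0≤height : 0ℚ ℚ.≤ arcHeight² p q x
  0≤height = subst (0ℚ ℚ.≤_) (onArc⇒height p q x onArc) (proj₁ onArc)
  p≰l : ¬ l < p
  p≰l l<p = <⇒≱ (neg*pos (p<q⇒p-q<0 x<p) (p<q⇒0<q-p x<q)) 0≤height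
    where
    x<p = ℚ.<-≤-trans x<l+1 (⟦⟧-mono-≤ l<p)
    x<q = ℚ.<-trans x<p (⟦⟧-mono-< p<q)
  q≰l : ¬ q ≤ l
  q≰l q≤l = <⇒≱ (pos*neg (p<q⇒0<q-p p<x) (p<q⇒p-q<0 q<x)) 0≤height
    where
    q<x = ℚ.≤-<-trans (⟦⟧-mono-≤ q≤l) l<x
    p<x = ℚ.<-trans (⟦⟧-mono-< p<q) q<x

Arc : Edge → Set
Arc e = spine e ≡ false

ArcInside : Edge → Edge → Set
ArcInside e e' = Arc e × Arc e' × src e' < src e × tgt e < tgt e'

-- A combinatorial certificate that the curves of e and e' do not meet above (l, l+1).
Apart : ℕ → Edge → Edge → Set
Apart l e e' = Covers l e → Covers l e' → spine e ≢ spine e' ⊎ ArcInside e e'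

arc-above-axis : Covers l (edge p q false) → InOpenUnit l x → OnCurve (edge p q false) (x , Y) → 0ℚ ℚ.< Y
arc-above-axis {p = p} {q} {x = x} cov I onArc =
  subst (0ℚ ℚ.<_) (sym (onArc⇒height p q x onArc)) (arcHeight²-pos cov I)

on-axis-arc-disjoint : Covers l (edge p q false) → InOpenUnit l x →
                       Y ≡ 0ℚ → OnCurve (edge p q false) (x , Y) → ⊥
on-axis-arc-disjoint cov I Y≡0 onArc = ℚ.<-irrefl (sym Y≡0) (arc-above-axis cov I onArc)

covering-disjoint : Covers l e → Covers l e' → InOpenUnit l x → OnCurve e (x , Y) → OnCurve e' (x , Y) →
                    spine e ≢ spine e' ⊎ ArcInside e e' → ⊥
covering-disjoint {e = edge _ _ true}  {edge _ _ true}  _   _    _ _  _   (inj₁ flags≢) = flags≢ refl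
covering-disjoint {e = edge _ _ false} {edge _ _ false} _   _    _ _  _   (inj₁ flags≢) = flags≢ refl
covering-disjoint {e = edge _ _ true}  {edge _ _ false} _   cov' I on on' (inj₁ _) =
  on-axis-arc-disjoint cov' I (proj₁ on) on'
covering-disjoint {e = edge _ _ false} {edge _ _ true}  cov _    I on on' (inj₁ _) =
  on-axis-arc-disjoint cov I (proj₁ on') on
covering-disjoint {e = edge p q false} {edge p' q' false} {x = x} cov _ I on on'
                  (inj₂ (_ , _ , p'<p , q<q')) =
  ℚ.<-irrefl (trans (sym (onArc⇒height p q x on)) (onArc⇒height p' q' x on'))
             (arcHeight²-<-nested p'<p q<q' cov I)

apart⇒disjoint : Apart l e e' → Forward e → Forward e' → InOpenUnit l x →
                 OnCurve e (x , Y) → OnCurve e' (x , Y) → ⊥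
apart⇒disjoint apart fw fw' I on on' = covering-disjoint cov cov' I on on' (apart cov cov')
  where
  cov  = onCurve⇒covers fw I on
  cov' = onCurve⇒covers fw' I on'

arcs-cross : ∀ {P L H Q} → P ℚ.< L → L ℚ.< H → H ℚ.< Q →
             ∃ λ x → L ℚ.< x × x ℚ.< H × (x - P) * (H - x) ≡ (x - L) * (Q - x)
arcs-cross {P} {L} {H} {Q} P<L L<H H<Q = x₀ , L<x₀ , x₀<H , heights≡
  where
  a = L - P
  h = H - L
  D = (Q - H) + a
  0<a : 0ℚ ℚ.< a
  0<a = p<q⇒0<q-p P<L
  0<h : 0ℚ ℚ.< h
  0<h = p<q⇒0<q-p L<H
  a<D : a ℚ.< D
  a<D = subst (ℚ._< D) (ℚ.+-identityˡ a) (ℚ.+-monoˡ-< a (p<q⇒0<q-p H<Q))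
  0<D : 0ℚ ℚ.< D
  0<D = ℚ.<-trans 0<a a<D
  instance
    D≢0 : ℚ.NonZero D
    D≢0 = ℚ.>-nonZero 0<D
  u = a * 1/ D
  uD≡a : u * D ≡ a
  uD≡a = trans (ℚ.*-assoc a (1/ D) D) (trans (cong (a *_) (ℚ.*-inverseˡ D)) (ℚ.*-identityʳ a))
  0<u : 0ℚ ℚ.< u
  0<u = ℚ.*-cancelʳ-<-nonNeg D {{ℚ.pos⇒nonNeg D {{ℚ.positive 0<D}}}}
          (subst₂ ℚ._<_ (sym (ℚ.*-zeroˡ D)) (sym uD≡a) 0<a)
  u<1 : u ℚ.< 1ℚ
  u<1 = ℚ.*-cancelʳ-<-nonNeg D {{ℚ.pos⇒nonNeg D {{ℚ.positive 0<D}}}}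
          (subst₂ ℚ._<_ (sym uD≡a) (sym (ℚ.*-identityˡ D)) a<D)
  x₀ = L + u * h
  L<x₀ : L ℚ.< x₀
  L<x₀ = subst (ℚ._< x₀) (ℚ.+-identityʳ L) (ℚ.+-monoʳ-< L (pos*pos 0<u 0<h))
  x₀<H : x₀ ℚ.< H
  x₀<H = subst (x₀ ℚ.<_) (solve 2 (λ L H → L :+ (H :- L) := H) refl L H)
          (ℚ.+-monoʳ-< L (subst (u * h ℚ.<_) (ℚ.*-identityˡ h) (ℚ.*-monoˡ-<-pos h {{ℚ.positive 0<h}} u<1)))
    where open +-*-Solver
  -- The two heights differ by an affine function of the abscissa, vanishing where u * D ≡ a.
  heights≡ : (x₀ - P) * (H - x₀) ≡ (x₀ - L) * (Q - x₀)
  heights≡ = begin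
    (x₀ - P) * (H - x₀)    ≡⟨ solve 5 (λ P L H Q u →
                                  (L :+ u :* (H :- L) :- P) :* (H :- (L :+ u :* (H :- L)))
                               := (L :+ u :* (H :- L) :- L) :* (Q :- (L :+ u :* (H :- L)))
                                  :+ (H :- L) :* ((L :- P) :- u :* ((Q :- H) :+ (L :- P)))) refl P L H Q u ⟩
    K + h * (a - u * D)    ≡⟨ cong (λ c → K + h * (a - c)) uD≡a ⟩
    K + h * (a - a)        ≡⟨ cong (λ c → K + h * c) (ℚ.+-inverseʳ a) ⟩
    K + h * 0ℚ             ≡⟨ cong (K +_) (ℚ.*-zeroʳ h) ⟩
    K + 0ℚ                 ≡⟨ ℚ.+-identityʳ K ⟩
    K                      ∎
    where
    open ≡-Reasoning
    open +-*-Solver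
    K = (x₀ - L) * (Q - x₀)

unit-crossing : p < l → suc l < q →
  ∃ λ pt → OnCurve (edge p (suc l) false) pt × OnCurve (edge l q false) pt × InOpenUnit l (proj₁ pt)
unit-crossing {p} {l} {q} p<l l+1<q =
  (x₀ , y²) , height⇒onArc p (suc l) x₀ 0≤y² refl , height⇒onArc l q x₀ 0≤y² heights≡ , I
  where
  cross = arcs-cross (⟦⟧-mono-< p<l) (⟦⟧-mono-< (ℕ.n<1+n l)) (⟦⟧-mono-< l+1<q)
  x₀ = proj₁ cross
  I : InOpenUnit l x₀
  I = proj₁ (proj₂ cross) , proj₁ (proj₂ (proj₂ cross))
  heights≡ = proj₂ (proj₂ (proj₂ cross))
  y² = arcHeight² p (suc l) x₀
  0≤y² = ℚ.<⇒≤ (arcHeight²-pos {b = false} (covers (ℕ.<⇒≤ p<l) (ℕ.n<1+n l)) I)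

AllPairs-lookup : ∀ {R : A → A → Set} {xs : List A} → AllPairs R xs → ∀ {i j} → i ≢ j →
                  R (List.lookup xs i) (List.lookup xs j) ⊎ R (List.lookup xs j) (List.lookup xs i)
AllPairs-lookup (_ ∷ _)   {Fin.zero}  {Fin.zero}  i≢j = ⊥-elim (i≢j refl)
AllPairs-lookup (Rx ∷ _)  {Fin.zero}  {Fin.suc j} _   = inj₁ (All.lookup Rx (∈-lookup j))
AllPairs-lookup (Rx ∷ _)  {Fin.suc i} {Fin.zero}  _   = inj₂ (All.lookup Rx (∈-lookup i))
AllPairs-lookup (_ ∷ Rxs) {Fin.suc i} {Fin.suc j} i≢j = AllPairs-lookup Rxs (i≢j ∘ cong Fin.suc)

no-crossing : All Forward es → AllPairs (Apart l) es → ¬ CrossingBetween es ⟦ l ⟧ ⟦ suc l ⟧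
no-crossing fw apart (i , j , i≢j , _ , on , on' , l<x , x<l+1) =
  [ (λ a → apart⇒disjoint a (forward i) (forward j) I on on')
  , (λ a → apart⇒disjoint a (forward j) (forward i) I on' on) ] (AllPairs-lookup apart i≢j)
  where
  forward = λ i → All.lookup fw (∈-lookup i)
  I = l<x , x<l+1

crossing : e ∈ es → e' ∈ es → e ≢ e' →
           (∃ λ pt → OnCurve e pt × OnCurve e' pt × InOpenUnit l (proj₁ pt)) →
           CrossingBetween es ⟦ l ⟧ ⟦ suc l ⟧
crossing {e} {es} {e'} e∈ e'∈ e≢e' (pt , on , on' , l<x , x<l+1) =
  index e∈ , index e'∈ , i≢j , pt , onCurve e∈ on , onCurve e'∈ on' , l<x , x<l+1
  where
  onCurve : ∀ {e} (e∈ : e ∈ es) → OnCurve e pt → OnCurve (List.lookup es (index e∈)) pt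
  onCurve e∈ = subst (λ e → OnCurve e pt) (lookup-index e∈)
  i≢j : index e∈ ≢ index e'∈
  i≢j i≡j = e≢e' (trans (lookup-index e∈) (trans (cong (List.lookup es) i≡j) (sym (lookup-index e'∈))))

ones-lower : ∀ i bs → All (i ≤_) (ones i bs)
ones-lower i []           = []
ones-lower i (true ∷ bs)  = ℕ.≤-refl ∷ All.map ℕ.<⇒≤ (ones-lower (suc i) bs)
ones-lower i (false ∷ bs) = All.map ℕ.<⇒≤ (ones-lower (suc i) bs)

ones-increasing : ∀ i bs → AllPairs _<_ (ones i bs)
ones-increasing i []           = []
ones-increasing i (true ∷ bs)  = ones-lower (suc i) bs ∷ ones-increasing (suc i) bs
ones-increasing i (false ∷ bs) = ones-increasing (suc i) bs

ones-upper : ∀ i bs → All (_< i ℕ.+ length bs) (ones i bs)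
ones-upper i []           = []
ones-upper i (true ∷ bs)  = ℕ.m<m+n i ℕ.z<s ∷ All.map (λ {j} → subst (j <_) (sym (ℕ.+-suc i _))) (ones-upper _ bs)
ones-upper i (false ∷ bs) = All.map (λ {j} → subst (j <_) (sym (ℕ.+-suc i _))) (ones-upper _ bs)

zeros≡ones-not : ∀ i bs → zeros i bs ≡ ones i (List.map not bs)
zeros≡ones-not i []           = refl
zeros≡ones-not i (true ∷ bs)  = zeros≡ones-not (suc i) bs
zeros≡ones-not i (false ∷ bs) = cong (i ∷_) (zeros≡ones-not (suc i) bs)

∈ones⇒lookup≡true : ∀ {m} i (v : Vec Bool m) f → i ℕ.+ toℕ f ∈ ones i (toList v) → lookup v f ≡ true
∈ones⇒lookup≡true i (true Vec.∷ v)  Fin.zero    _       = refl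
∈ones⇒lookup≡true i (false Vec.∷ v) Fin.zero    i∈      =
  ⊥-elim (ℕ.<-irrefl (sym (ℕ.+-identityʳ i)) (All.lookup (ones-lower (suc i) (toList v)) i∈))
∈ones⇒lookup≡true i (true Vec.∷ v)  (Fin.suc f) (here eq) =
  ⊥-elim (ℕ.<-irrefl (sym eq) (ℕ.m<m+n i ℕ.z<s))
∈ones⇒lookup≡true i (true Vec.∷ v)  (Fin.suc f) (there i+f∈) =
  ∈ones⇒lookup≡true (suc i) v f (subst (_∈ ones (suc i) (toList v)) (ℕ.+-suc i (toℕ f)) i+f∈)
∈ones⇒lookup≡true i (false Vec.∷ v) (Fin.suc f) i+f∈ =
  ∈ones⇒lookup≡true (suc i) v f (subst (_∈ ones (suc i) (toList v)) (ℕ.+-suc i (toℕ f)) i+f∈)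

lookup≡true⇒∈ones : ∀ {m} i (v : Vec Bool m) f → lookup v f ≡ true → i ℕ.+ toℕ f ∈ ones i (toList v)
lookup≡true⇒∈ones i (true Vec.∷ v)  Fin.zero    _  = here (ℕ.+-identityʳ i)
lookup≡true⇒∈ones i (true Vec.∷ v)  (Fin.suc f) vf =
  there (subst (_∈ ones (suc i) (toList v)) (sym (ℕ.+-suc i (toℕ f))) (lookup≡true⇒∈ones (suc i) v f vf))
lookup≡true⇒∈ones i (false Vec.∷ v) (Fin.suc f) vf =
  subst (_∈ ones (suc i) (toList v)) (sym (ℕ.+-suc i (toℕ f))) (lookup≡true⇒∈ones (suc i) v f vf)

chain-arcs : ∀ s js t → All Arc (chain s js t)
chain-arcs s []       t = refl ∷ []
chain-arcs s (j ∷ js) t = refl ∷ chain-arcs (suc j) js t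

chain-forward : ∀ js → All (s ≤_) js → AllPairs _<_ js → All (λ j → suc (suc j) < t) js → s < t →
                All Forward (chain s js t)
chain-forward []       []          []            []             s<t = s<t ∷ []
chain-forward (j ∷ js) (s≤j ∷ _) (j<js ∷ incr) (j+2<t ∷ bounds) _  =
  s≤s (ℕ.m≤n⇒m≤1+n s≤j) ∷ chain-forward js j<js incr bounds (ℕ.<-trans (ℕ.n<1+n _) j+2<t)

chain-src-lower : ∀ js → All (s ≤_) js → AllPairs _<_ js → All (λ e → s ≤ src e) (chain s js t)
chain-src-lower []       []        []            = ℕ.≤-refl ∷ []
chain-src-lower (j ∷ js) (s≤j ∷ _) (j<js ∷ incr) =
  ℕ.≤-refl ∷ All.map (ℕ.≤-trans (ℕ.m≤n⇒m≤1+n s≤j)) (chain-src-lower js j<js incr)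

covers-unit : Covers l (edge p (suc p) b) → p ≡ l
covers-unit (covers p≤l l<p+1) = ℕ.≤-antisym p≤l (ℕ.≤-pred l<p+1)

-- Consecutive chain edges overlap only on [j+1, j+2], where j is the position of a 1.
chain-apart : ∀ {k} js → k ∉ js → AllPairs _<_ js → AllPairs (Apart (suc k)) (chain s js t)
chain-apart []       _  []            = [] ∷ []
chain-apart (j ∷ js) k∉ (j<js ∷ incr) =
  All.map first-apart (chain-src-lower js j<js incr) ∷ chain-apart js (k∉ ∘ there) incr
  where
  first-apart : suc j ≤ src e → Apart _ (edge _ (suc (suc j)) false) e
  first-apart j+1≤src (covers _ k<j+2) (covers src≤k+1 _) =
    ⊥-elim (k∉ (here (ℕ.≤-antisym (ℕ.≤-pred (ℕ.≤-pred k<j+2)) (ℕ.≤-pred (ℕ.≤-trans j+1≤src src≤k+1)))))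

≤-suc∧≢⇒≤ : ∀ {m n} → m ≤ suc n → m ≢ suc n → m ≤ n
≤-suc∧≢⇒≤ m≤n+1 m≢n+1 = ℕ.≤-pred (ℕ.≤∧≢⇒< m≤n+1 m≢n+1)

chain-covering-long : ∀ {k} js → k ∉ js → s ≢ suc k → t ≢ suc (suc k) →
                      All (λ e → Covers (suc k) e → src e ≤ k × suc (suc k) < tgt e) (chain s js t)
chain-covering-long []       _  s≢k+1 t≢k+2 =
  (λ (covers s≤k+1 k<t) → ≤-suc∧≢⇒≤ s≤k+1 s≢k+1 , ℕ.≤∧≢⇒< k<t (t≢k+2 ∘ sym)) ∷ []
chain-covering-long (j ∷ js) k∉ s≢k+1 t≢k+2 =
  (λ (covers s≤k+1 k<j+2) → ≤-suc∧≢⇒≤ s≤k+1 s≢k+1 , s≤s (s≤s (ℕ.≤∧≢⇒< (ℕ.≤-pred (ℕ.≤-pred k<j+2)) (k∉ ∘ here))))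
  ∷ chain-covering-long js (k∉ ∘ there) (k∉ ∘ here ∘ sym ∘ ℕ.suc-injective) t≢k+2

chain-head : ∀ js → All (i <_) js → suc (suc i) < t →
             ∃ λ q → suc (suc i) < q × edge (suc i) q false ∈ chain (suc i) js t
chain-head []        []          i+2<t = _ , i+2<t , here refl
chain-head (j ∷ js) (i<j ∷ _)    _     = suc (suc j) , s≤s (s≤s i<j) , here refl

chain-consecutive : ∀ {k} js → k ∈ js → All (s ≤_) js → AllPairs _<_ js → All (λ j → suc (suc j) < t) js →
  ∃₂ λ p q → p < suc k × suc (suc k) < q ×
             edge p (suc (suc k)) false ∈ chain s js t × edge (suc k) q false ∈ chain s js t
chain-consecutive (j ∷ js) (here refl) (s≤j ∷ _) (j<js ∷ _) (j+2<t ∷ _) =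
  let q , j+2<q , next∈ = chain-head js j<js j+2<t in
  _ , q , s≤s s≤j , j+2<q , here refl , there next∈
chain-consecutive (j ∷ js) (there k∈) (_ ∷ _) (j<js ∷ incr) (_ ∷ bounds) =
  let p , q , p<k+1 , k+2<q , e∈ , e'∈ = chain-consecutive js k∈ j<js incr bounds in
  p , q , p<k+1 , k+2<q , there e∈ , there e'∈

units-forward : ∀ is → All Forward (List.map (λ i → edge (suc i) (suc (suc i)) b) is)
units-forward is = All.map⁺ (All.universal (λ i → ℕ.n<1+n (suc i)) is)

units-apart : AllPairs _<_ js → AllPairs (Apart l) (List.map (λ i → edge (suc i) (suc (suc i)) b) js)
units-apart incr = AllPairs.map⁺ (AllPairs.map unit-edges-apart incr)
  where
  unit-edges-apart : ∀ {i j} → i < j → Apart l (edge (suc i) (suc (suc i)) b) (edge (suc j) (suc (suc j)) b)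
  unit-edges-apart i<j c c' =
    ⊥-elim (ℕ.<-irrefl (ℕ.suc-injective (trans (covers-unit c) (sym (covers-unit c')))) i<j)

uncovered-++ : ∀ {xs ys} → All (λ e → ¬ Covers l e) xs → AllPairs (Apart l) ys →
               AllPairs (Apart l) (xs ++ ys)
uncovered-++ []           apart = apart
uncovered-++ (¬c ∷ ¬cs) apart = All.universal (λ _ c → ⊥-elim (¬c c)) _ ∷ uncovered-++ ¬cs apart

spine-arc-apart : Arc e' → Apart l (edge p q true) e'
spine-arc-apart refl _ _ = inj₁ (λ ())

unit-inside-long : ∀ {k} → Arc e × (Covers (suc k) e → src e ≤ k × suc (suc k) < tgt e) →
                   Apart (suc k) (edge (suc i) (suc (suc i)) false) e
unit-inside-long (arc , long) cu ce with covers-unit cu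
... | refl = inj₂ (refl , arc , s≤s (proj₁ (long ce)) , proj₂ (long ce))

module _ (n' : ℕ) (b : Vec Bool n') where
  private
    n : ℕ
    n = suc (suc n')
    bits : List Bool
    bits = toList b
    S X Z C : List Edge
    S = List.map (λ i → edge (suc i) (suc (suc i)) true) (upTo n)
    X = edge 1 2 false ∷ edge n (suc n) false ∷ []
    Z = List.map (λ l → edge (suc l) (suc (suc l)) false) (zeros 1 bits)
    C = chain 1 (ones 1 bits) (suc n)

    positions-upper : All (λ j → suc (suc j) < suc n) (ones 1 bits)
    positions-upper =
      All.map (λ {j} → s≤s ∘ s≤s ∘ subst (j <_) (cong suc (Vec.length-toList b))) (ones-upper 1 bits)

  G-forward : All Forward (G n b)
  G-forward =
    All.++⁺ (units-forward (upTo n)) (ℕ.n<1+n 1 ∷ ℕ.n<1+n n ∷ All.++⁺ (units-forward (zeros 1 bits))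
      (chain-forward _ (ones-lower 1 bits) (ones-increasing 1 bits) positions-upper (s≤s (s≤s z≤n))))

  G-apart : (kf : Fin n') → lookup b kf ≡ false → AllPairs (Apart (suc (suc (toℕ kf)))) (G n b)
  G-apart kf bk≡false =
    AllPairs.++⁺ (units-apart (AllPairs.applyUpTo⁺₁ (λ i → i) n (λ i<j _ → i<j)))
      (uncovered-++ X-uncovered
        (AllPairs.++⁺ (units-apart zeros-increasing) (chain-apart _ k∉ (ones-increasing 1 bits)) Z×C))
      S×rest
    where
    k = suc (toℕ kf)
    k∉ : k ∉ ones 1 bits
    k∉ k∈ with trans (sym bk≡false) (∈ones⇒lookup≡true 1 b kf k∈)
    ... | ()
    zeros-increasing : AllPairs _<_ (zeros 1 bits)
    zeros-increasing =
      subst (AllPairs _<_) (sym (zeros≡ones-not 1 bits)) (ones-increasing 1 (List.map not bits))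
    X-uncovered : All (λ e → ¬ Covers (suc k) e) X
    X-uncovered = (λ { (covers _ (s≤s (s≤s ()))) })
                ∷ (λ (covers n≤k+1 _) → ℕ.<⇒≱ (Fin.toℕ<n kf) (ℕ.≤-pred (ℕ.≤-pred n≤k+1)))
                ∷ []
    rest-arcs : All Arc (X ++ Z ++ C)
    rest-arcs = refl ∷ refl ∷ All.++⁺ {xs = Z} (All.map⁺ (All.universal (λ _ → refl) _)) (chain-arcs 1 _ _)
    S×rest : All (λ e → All (Apart (suc k) e) (X ++ Z ++ C)) S
    S×rest = All.map⁺ (All.universal (λ _ → All.map (spine-arc-apart {l = suc k}) rest-arcs) (upTo n))
    Z×C : All (λ e → All (Apart (suc k) e) C) Z
    Z×C = All.map⁺ (All.universal (λ _ → All.zipWith unit-inside-long (chain-arcs 1 _ _ , long)) (zeros 1 bits))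
      where
      long = chain-covering-long _ k∉ (λ ())
               (λ n+1≡k+2 → ℕ.<-irrefl (sym (cong (ℕ._∸ 3) n+1≡k+2)) (Fin.toℕ<n kf))

  G-consecutive : (kf : Fin n') → lookup b kf ≡ true →
    let l = suc (suc (toℕ kf)) in
    ∃₂ λ p q → p < l × suc l < q × edge p (suc l) false ∈ G n b × edge l q false ∈ G n b
  G-consecutive kf bk≡true =
    let p , q , p<l , l+1<q , e∈ , e'∈ = chain-consecutive _ (lookup≡true⇒∈ones 1 b kf bk≡true)
                                           (ones-lower 1 bits) (ones-increasing 1 bits) positions-upper
    in p , q , p<l , l+1<q , inG e∈ , inG e'∈
    where
    inG : e ∈ C → e ∈ G n b
    inG = ∈-++⁺ʳ S ∘ ∈-++⁺ʳ X ∘ ∈-++⁺ʳ Z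

proposition5p9 : (n : ℕ) → 2 ≤ n → (b : Vec Bool (n ∸ 2)) → (kf : Fin (n ∸ 2)) →
    (CrossingBetween (G n b) ⟦ suc (suc (toℕ kf)) ⟧ ⟦ suc (suc (suc (toℕ kf))) ⟧ → lookup b kf ≡ true)
    × (lookup b kf ≡ true → CrossingBetween (G n b) ⟦ suc (suc (toℕ kf)) ⟧ ⟦ suc (suc (suc (toℕ kf))) ⟧)
proposition5p9 (suc (suc n')) (s≤s (s≤s z≤n)) b kf = only-if , if
  where
  lo = suc (suc (toℕ kf))
  only-if : CrossingBetween (G (suc (suc n')) b) ⟦ lo ⟧ ⟦ suc lo ⟧ → lookup b kf ≡ true
  only-if cross with lookup b kf in bk
  ... | true  = refl
  ... | false = ⊥-elim (no-crossing (G-forward n' b) (G-apart n' b kf bk) cross)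
  if : lookup b kf ≡ true → CrossingBetween (G (suc (suc n')) b) ⟦ lo ⟧ ⟦ suc lo ⟧
  if bk =
    let p , q , p<lo , lo+1<q , e∈ , e'∈ = G-consecutive n' b kf bk
    in crossing {l = lo} e∈ e'∈ (λ same → ℕ.<-irrefl (cong tgt same) lo+1<q) (unit-crossing p<lo lo+1<q)
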